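{- Let $\sigma$ be a partition of a positive integer $r$ with smallest part $\delta$, let $n,q$ be positive integers, let $H=H(n,r,q\mid\sigma)$, write $s=s(\sigma)$, and let $\beta$ be an integer with $2 \leq s \leq \beta$ and $\delta \geq r - \beta + 1$. Then $H$ has no gap in its $(2,\beta)$-spectrum below the $(2,\beta)$-monochromatic zone; that is, for every integer $k$ with $\chi_{2,\beta}(H) \le k \le \left\lceil \frac{n}{s-1}\right\rceil$, $H$ has a $k$-$(2,\beta)$-colouring.
   Context: For a partition $\sigma$ of $r$ and positive integers $n,q$, the $\sigma$-hypergraph $H(n,r,q\mid\sigma)$ is the $r$-uniform hypergraph whose vertex set has $nq$ vertices partitioned into $n$ classes $V_1,\dots,V_n$ of $q$ vertices each, and in which an $r$-subset $K$ of the vertex set is an edge if and only if the multiset of non-zero cardinalities $|K\cap V_i|$, $1\le i\le n$, is exactly the partition $\sigma$. $s(\sigma)$ denotes the number of parts of $\sigma$ and $\delta$ its smallest part. A $(2,\beta)$-colouring is an assignment of colours to the vertices such that every edge contains at least $2$ and at most $\beta$ distinct colours; a $k$-$(2,\beta)$-colouring is one using exactly $k$ colours. The $(2,\beta)$-spectrum is the set of $k$ for which a $k$-$(2,\beta)$-colouring exists, and $\chi_{2,\beta}(H)$ is its minimum. The $(2,\beta)$-monochromatic zone is the set of $k$ for which there is a $k$-$(2,\beta)$-colouring with every class monochromatic; under the hypotheses its smallest element is $\lceil n/(s-1)\rceil$. -}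

module Defs where

open import Data.Nat using (ℕ; zero; suc; _+_; _≤_; _<_; _≟_)
open import Data.Nat.DivMod using (_/_)
open import Data.Bool using (Bool; _∧_)
open import Data.Fin using (Fin)
import Data.Fin as F
open import Data.Fin.Subset using (Subset; ∣_∣)
open import Data.Vec using (lookup; tabulate)
open import Data.List using (List; map; filter; allFin)
open import Data.Nat.ListAction using (sum)
open import Data.Bool.ListAction using (any)
open import Data.List.Membership.Propositional using (_∈_)
open import Data.List.Relation.Unary.All using (All)
open import Data.List.Relation.Binary.Permutation.Propositional using (_↭_)
open import Data.Product using (Σ; ∃; ∃-syntax; _×_)
open import Relation.Binary.PropositionalEquality using (_≡_)
open import Relation.Nullary.Decidable using (⌊_⌋)

-- A partition σ of r: a list of positive parts summing to r
-- (order of the list is irrelevant; it is compared up to permutation).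
IsPartition : List ℕ → ℕ → Set
IsPartition σ r = All (λ p → 1 ≤ p) σ × sum σ ≡ r

IsSmallestPart : ℕ → List ℕ → Set
IsSmallestPart δ σ = δ ∈ σ × All (λ p → δ ≤ p) σ

-- Vertices of H(n,r,q|σ): pairs (i , j), i : Fin n the class, j : Fin q.
-- A vertex subset K is given class by class: K i : Subset q is K ∩ V_i.
VSubset : ℕ → ℕ → Set
VSubset n q = Fin n → Subset q

nonzeroCards : ∀ {n q} → VSubset n q → List ℕ
nonzeroCards {n} K = filter (λ c → Relation.Nullary.¬? (c ≟ 0)) (map (λ i → ∣ K i ∣) (allFin n))
  where import Relation.Nullary

-- K is an edge of H(n,r,q|σ): the multiset of non-zero |K ∩ V_i| equals σ
-- (this forces |K| = sum σ = r).
IsEdge : ∀ {n q} → List ℕ → VSubset n q → Set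
IsEdge σ K = nonzeroCards K ↭ σ

Colouring : ℕ → ℕ → ℕ → Set
Colouring n q k = Fin n → Fin q → Fin k

UsesAll : ∀ {n q k} → Colouring n q k → Set
UsesAll {n} {q} {k} c = (x : Fin k) → ∃[ i ] ∃[ j ] (c i j ≡ x)

coloursOn : ∀ {n q k} → Colouring n q k → VSubset n q → Subset k
coloursOn {n} {q} {k} c K =
  tabulate (λ x → any (λ i → any (λ j → lookup (K i) j ∧ ⌊ c i j F.≟ x ⌋) (allFin q)) (allFin n))

numColours : ∀ {n q k} → Colouring n q k → VSubset n q → ℕ
numColours c K = ∣ coloursOn c K ∣

Is2βColouring : ∀ {n q k} → List ℕ → ℕ → Colouring n q k → Set
Is2βColouring {n} {q} σ β c =
  (K : VSubset n q) → IsEdge σ K → 2 ≤ numColours c K × numColours c K ≤ β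

InSpectrum : ℕ → ℕ → List ℕ → ℕ → ℕ → Set
InSpectrum n q σ β k = Σ (Colouring n q k) (λ c → UsesAll c × Is2βColouring σ β c)

IsChi2β : ℕ → ℕ → List ℕ → ℕ → ℕ → Set
IsChi2β n q σ β χ = InSpectrum n q σ β χ × (∀ k → InSpectrum n q σ β k → χ ≤ k)

-- ceiling division ⌈ m / d ⌉ (junk value 0 for d = 0)
ceilDiv : ℕ → ℕ → ℕ
ceilDiv m zero = 0
ceilDiv m (suc d) = (m + d) / suc d

module Submission where

-- Climb from χ one colour at a time while k < n. By pigeonhole some class V i
-- has every colour of a k-colouring also appearing outside V i; repainting V i
-- with a fresh colour then uses exactly k + 1 colours. Edges missing V i keep
-- their colours. An edge meeting V i also meets another class (each part of σ
-- is smaller than r), so it sees at least 2 colours; and it sees at most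
-- 1 + (r − δ) ≤ β colours, since V i contributes only the fresh colour but at
-- least δ vertices. Finally ⌈n/(s−1)⌉ ≤ n.

open import Defs
open import Data.Nat using (ℕ; zero; suc; _+_; _*_; _∸_; _≤_; _<_; _≟_; z≤n; s≤s; s≤s⁻¹; _≤′_; ≤′-refl; ≤′-step)
open import Data.Nat.Properties
open import Algebra.Properties.CommutativeSemigroup +-commutativeSemigroup using (x∙yz≈y∙xz)
open import Data.Nat.DivMod using (m<n*o⇒m/o<n)
open import Data.Nat.ListAction using (sum)
open import Data.Nat.ListAction.Properties using (sum-↭)
open import Data.Bool using (Bool; T)
open import Data.Bool.Properties using (T-≡; T-∧)
open import Data.Fin as F using (Fin; zero; suc)
import Data.Fin.Properties as FinP
open import Data.Fin.Subset using (Subset; inside; outside; _∈_; _⊆_; _∪_; ⋃; ⊥; ⁅_⁆; ∣_∣; Nonempty)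
open import Data.Fin.Subset.Properties
  using (x∈p∪q⁺; x∈p∪q⁻; ∣⊥∣≡0; ∣⁅x⁆∣≡1; x∈⁅x⁆; x∈⁅y⁆⇒x≡y; ∉⊥; p⊆q⇒∣p∣≤∣q∣; ⊆-antisym; x∈p⇒∣p-x∣<∣p∣; nonempty?; Empty-unique)
open import Data.Vec using ([]; _∷_; here; there; lookup; tabulate)
open import Data.Vec.Properties using (lookup∘tabulate; []=⇒lookup; lookup⇒[]=)
open import Data.List as L using (List; []; _∷_; map; filter; allFin; length)
open import Data.List.Properties using (map-tabulate)
import Data.List.Membership.Propositional as List
open import Data.List.Membership.Propositional.Properties using (∈-filter⁺; ∈-map⁺; ∈-allFin)
open import Data.List.Relation.Unary.All as All using (All; _∷_)
open import Data.List.Relation.Unary.Any using (here; there)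
open import Data.List.Relation.Unary.Any.Properties using (any⁺; any⁻; tabulate⁺; tabulate⁻)
open import Data.List.Relation.Binary.Permutation.Propositional.Properties using (∈-resp-↭)
open import Data.Product using (∃; ∃₂; _×_; _,_; proj₁; proj₂)
open import Data.Sum using (inj₁; inj₂)
open import Data.Unit using (tt)
open import Function using (_∘_; const; _⇔_; mk⇔; Equivalence)
open import Relation.Nullary using (¬_; Dec; yes; no; ¬?; contradiction)
open import Relation.Nullary.Decidable using (⌊_⌋; _×-dec_)
open import Relation.Binary.PropositionalEquality

private
  variable
    m n : ℕ

∣p∪q∣≤∣p∣+∣q∣ : (p q : Subset n) → ∣ p ∪ q ∣ ≤ ∣ p ∣ + ∣ q ∣
∣p∪q∣≤∣p∣+∣q∣ []            []      = z≤n
∣p∪q∣≤∣p∣+∣q∣ (outside ∷ p) (outside ∷ q) = ∣p∪q∣≤∣p∣+∣q∣ p q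
∣p∪q∣≤∣p∣+∣q∣ (outside ∷ p) (inside ∷ q)  =
  subst (suc ∣ p ∪ q ∣ ≤_) (sym (+-suc ∣ p ∣ ∣ q ∣)) (s≤s (∣p∪q∣≤∣p∣+∣q∣ p q))
∣p∪q∣≤∣p∣+∣q∣ (inside ∷ p)  (outside ∷ q) = s≤s (∣p∪q∣≤∣p∣+∣q∣ p q)
∣p∪q∣≤∣p∣+∣q∣ (inside ∷ p)  (inside ∷ q)  =
  s≤s (≤-trans (∣p∪q∣≤∣p∣+∣q∣ p q) (+-monoʳ-≤ ∣ p ∣ (n≤1+n ∣ q ∣)))

x∈p⇒1≤∣p∣ : {x : Fin n} {p : Subset n} → x ∈ p → 1 ≤ ∣ p ∣
x∈p⇒1≤∣p∣ x∈p = ≤-trans (s≤s z≤n) (x∈p⇒∣p-x∣<∣p∣ x∈p)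

zero∈p⇒suc∈p⇒2≤∣p∣ : {x : Fin n} {p : Subset (suc n)} → zero ∈ p → suc x ∈ p → 2 ≤ ∣ p ∣
zero∈p⇒suc∈p⇒2≤∣p∣ here (there x∈p) = s≤s (x∈p⇒1≤∣p∣ x∈p)

∈-⋃⁺ : {x : Fin n} {p : Subset n} {ps : List (Subset n)} → p List.∈ ps → x ∈ p → x ∈ ⋃ ps
∈-⋃⁺ (here refl) x∈p = x∈p∪q⁺ (inj₁ x∈p)
∈-⋃⁺ (there p∈ps) x∈p = x∈p∪q⁺ (inj₂ (∈-⋃⁺ p∈ps x∈p))

∣⋃∣≤sum : (ps : List (Subset n)) → ∣ ⋃ ps ∣ ≤ sum (map ∣_∣ ps)
∣⋃∣≤sum {n} [] = ≤-reflexive (∣⊥∣≡0 n)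
∣⋃∣≤sum (p ∷ ps) = ≤-trans (∣p∪q∣≤∣p∣+∣q∣ p (⋃ ps)) (+-monoʳ-≤ ∣ p ∣ (∣⋃∣≤sum ps))

image : (Fin m → Fin n) → Subset m → Subset n
image f []            = ⊥
image f (outside ∷ p) = image (f ∘ suc) p
image f (inside ∷ p)  = ⁅ f zero ⁆ ∪ image (f ∘ suc) p

∣image∣≤∣∣ : (f : Fin m → Fin n) (p : Subset m) → ∣ image f p ∣ ≤ ∣ p ∣
∣image∣≤∣∣ {n = n} f [] = ≤-reflexive (∣⊥∣≡0 n)
∣image∣≤∣∣ f (outside ∷ p) = ∣image∣≤∣∣ (f ∘ suc) p
∣image∣≤∣∣ f (inside ∷ p) = begin
  ∣ ⁅ f zero ⁆ ∪ image (f ∘ suc) p ∣        ≤⟨ ∣p∪q∣≤∣p∣+∣q∣ ⁅ f zero ⁆ _ ⟩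
  ∣ ⁅ f zero ⁆ ∣ + ∣ image (f ∘ suc) p ∣    ≤⟨ +-mono-≤ (≤-reflexive (∣⁅x⁆∣≡1 (f zero))) (∣image∣≤∣∣ (f ∘ suc) p) ⟩
  suc ∣ p ∣                                 ∎
  where open ≤-Reasoning

∈-image⁺ : (f : Fin m → Fin n) {p : Subset m} {x : Fin m} → x ∈ p → f x ∈ image f p
∈-image⁺ f here          = x∈p∪q⁺ (inj₁ (x∈⁅x⁆ (f zero)))
∈-image⁺ f {outside ∷ p} (there x∈p) = ∈-image⁺ (f ∘ suc) x∈p
∈-image⁺ f {inside ∷ p}  (there x∈p) = x∈p∪q⁺ (inj₂ (∈-image⁺ (f ∘ suc) x∈p))

image-const⊆⁅⁆ : {f : Fin m → Fin n} {y : Fin n} → (∀ x → f x ≡ y) → (p : Subset m) → image f p ⊆ ⁅ y ⁆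
image-const⊆⁅⁆ f≡y [] z∈⊥ = contradiction z∈⊥ ∉⊥
image-const⊆⁅⁆ f≡y (outside ∷ p) = image-const⊆⁅⁆ (f≡y ∘ suc) p
image-const⊆⁅⁆ {f = f} f≡y (inside ∷ p) z∈ with x∈p∪q⁻ ⁅ f zero ⁆ _ z∈
... | inj₁ z∈⁅f0⁆ = subst (_∈ ⁅ _ ⁆) (sym (trans (x∈⁅y⁆⇒x≡y _ z∈⁅f0⁆) (f≡y zero))) (x∈⁅x⁆ _)
... | inj₂ z∈img = image-const⊆⁅⁆ (f≡y ∘ suc) p z∈img

∑ : (Fin n → ℕ) → ℕ
∑ f = sum (L.tabulate f)

∑-zero : ∑ {n} (λ _ → 0) ≡ 0
∑-zero {zero}  = refl
∑-zero {suc n} = ∑-zero {n}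

∑-mono-≤ : {f g : Fin n → ℕ} → (∀ i → f i ≤ g i) → ∑ f ≤ ∑ g
∑-mono-≤ {zero}  f≤g = z≤n
∑-mono-≤ {suc n} f≤g = +-mono-≤ (f≤g zero) (∑-mono-≤ (f≤g ∘ suc))

∑-≤-except : {f g : Fin n → ℕ} (i : Fin n) → (∀ j → j ≢ i → f j ≤ g j) → ∑ f + g i ≤ f i + ∑ g
∑-≤-except {f = f} {g} zero f≤g = begin
  f zero + ∑ (f ∘ suc) + g zero   ≡⟨ +-assoc (f zero) _ _ ⟩
  f zero + (∑ (f ∘ suc) + g zero) ≤⟨ +-monoʳ-≤ (f zero) (+-monoˡ-≤ (g zero) (∑-mono-≤ (λ j → f≤g (suc j) λ ()))) ⟩
  f zero + (∑ (g ∘ suc) + g zero) ≡⟨ cong (f zero +_) (+-comm _ (g zero)) ⟩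
  f zero + ∑ g                    ∎
  where open ≤-Reasoning
∑-≤-except {f = f} {g} (suc i) f≤g = begin
  f zero + ∑ (f ∘ suc) + g (suc i)   ≡⟨ +-assoc (f zero) _ _ ⟩
  f zero + (∑ (f ∘ suc) + g (suc i)) ≤⟨ +-mono-≤ (f≤g zero (λ ())) (∑-≤-except i (λ j j≢i → f≤g (suc j) (j≢i ∘ FinP.suc-injective))) ⟩
  g zero + (f (suc i) + ∑ (g ∘ suc)) ≡⟨ x∙yz≈y∙xz (g zero) (f (suc i)) _ ⟩
  f (suc i) + ∑ g                    ∎
  where open ≤-Reasoning

sum-filter-nonzero : (ms : List ℕ) → sum (filter (λ m → ¬? (m ≟ 0)) ms) ≡ sum ms
sum-filter-nonzero [] = refl
sum-filter-nonzero (zero ∷ ms) = sum-filter-nonzero ms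
sum-filter-nonzero (suc m ∷ ms) = cong (suc m +_) (sum-filter-nonzero ms)

∈⇒≤sum : {m : ℕ} {ms : List ℕ} → m List.∈ ms → m ≤ sum ms
∈⇒≤sum (here refl) = m≤m+n _ _
∈⇒≤sum {ms = m′ ∷ _} (there m∈ms) = ≤-trans (∈⇒≤sum m∈ms) (m≤n+m _ m′)

∈⇒<sum : {m : ℕ} {ms : List ℕ} → All (1 ≤_) ms → 2 ≤ length ms → m List.∈ ms → m < sum ms
∈⇒<sum {ms = m ∷ m′ ∷ ms} (_ ∷ 1≤m′ ∷ _) _ (here refl) =
  subst (_≤ m + sum (m′ ∷ ms)) (+-comm m 1) (+-monoʳ-≤ m (≤-trans 1≤m′ (m≤m+n m′ _)))
∈⇒<sum {ms = m ∷ m′ ∷ ms} (1≤m ∷ _) _ (there m∈ms) = +-mono-≤ 1≤m (∈⇒≤sum m∈ms)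
∈⇒<sum {ms = _ ∷ []} _ (s≤s ()) _

T-⌊⌋ : {P : Set} (P? : Dec P) → T ⌊ P? ⌋ ⇔ P
T-⌊⌋ (yes p) = mk⇔ (const p) (const tt)
T-⌊⌋ (no ¬p) = mk⇔ (λ ()) ¬p

∈-tabulate⁺ : {f : Fin n → Bool} {x : Fin n} → T (f x) → x ∈ tabulate f
∈-tabulate⁺ {f = f} {x} t = lookup⇒[]= x (tabulate f) (trans (lookup∘tabulate f x) (Equivalence.to T-≡ t))

∈-tabulate⁻ : {f : Fin n → Bool} {x : Fin n} → x ∈ tabulate f → T (f x)
∈-tabulate⁻ {f = f} {x} x∈ = Equivalence.from T-≡ (trans (sym (lookup∘tabulate f x)) ([]=⇒lookup x∈))

∈⇒T-lookup : {x : Fin n} {p : Subset n} → x ∈ p → T (lookup p x)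
∈⇒T-lookup x∈p = Equivalence.from T-≡ ([]=⇒lookup x∈p)

T-lookup⇒∈ : {x : Fin n} {p : Subset n} → T (lookup p x) → x ∈ p
T-lookup⇒∈ {x = x} {p} t = lookup⇒[]= x p (Equivalence.to T-≡ t)

module _ {n q k : ℕ} (c : Colouring n q k) (K : VSubset n q) where

  ∈-coloursOn⁺ : {i : Fin n} {j : Fin q} → j ∈ K i → c i j ∈ coloursOn c K
  ∈-coloursOn⁺ {i} {j} j∈Ki = ∈-tabulate⁺ (any⁺ _ (tabulate⁺ i (any⁺ _ (tabulate⁺ j
    (Equivalence.from T-∧ (∈⇒T-lookup j∈Ki , Equivalence.from (T-⌊⌋ (c i j F.≟ c i j)) refl))))))

  ∈-coloursOn⁻ : {x : Fin k} → x ∈ coloursOn c K → ∃₂ λ i j → j ∈ K i × c i j ≡ x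
  ∈-coloursOn⁻ {x} x∈ with tabulate⁻ (any⁻ _ _ (∈-tabulate⁻ x∈))
  ... | i , t with tabulate⁻ (any⁻ _ _ t)
  ... | j , t′ with Equivalence.to T-∧ t′
  ... | j∈Ki , cij≡x = i , j , T-lookup⇒∈ j∈Ki , Equivalence.to (T-⌊⌋ (c i j F.≟ x)) cij≡x

  coloursOn⊆⋃image : coloursOn c K ⊆ ⋃ (L.tabulate (λ i → image (c i) (K i)))
  coloursOn⊆⋃image x∈ with ∈-coloursOn⁻ x∈
  ... | i , j , j∈Ki , refl = ∈-⋃⁺ (tabulate⁺ i refl) (∈-image⁺ (c i) j∈Ki)

  numColours≤∑∣image∣ : numColours c K ≤ ∑ (λ i → ∣ image (c i) (K i) ∣)
  numColours≤∑∣image∣ = begin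
    ∣ coloursOn c K ∣                                    ≤⟨ p⊆q⇒∣p∣≤∣q∣ coloursOn⊆⋃image ⟩
    ∣ ⋃ images ∣                                         ≤⟨ ∣⋃∣≤sum images ⟩
    sum (map ∣_∣ images)                                 ≡⟨ cong sum (map-tabulate (λ i → image (c i) (K i)) ∣_∣) ⟩
    ∑ (λ i → ∣ image (c i) (K i) ∣)                      ∎
    where
    open ≤-Reasoning
    images = L.tabulate (λ i → image (c i) (K i))

module _ {σ : List ℕ} {n q : ℕ} (K : VSubset n q) (edge : IsEdge σ K) where

  edge-∑ : ∑ (λ i → ∣ K i ∣) ≡ sum σ
  edge-∑ = begin
    ∑ (λ i → ∣ K i ∣)                                    ≡⟨ cong sum (map-tabulate (λ i → i) (λ i → ∣ K i ∣)) ⟨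
    sum (map (λ i → ∣ K i ∣) (allFin n))                 ≡⟨ sum-filter-nonzero (map (λ i → ∣ K i ∣) (allFin n)) ⟨
    sum (nonzeroCards K)                                 ≡⟨ sum-↭ edge ⟩
    sum σ                                                ∎
    where open ≡-Reasoning

  edge-∣class∣∈σ : {i : Fin n} {j : Fin q} → j ∈ K i → ∣ K i ∣ List.∈ σ
  edge-∣class∣∈σ {i} j∈Ki = ∈-resp-↭ edge
    (∈-filter⁺ (λ m → ¬? (m ≟ 0)) (∈-map⁺ (λ i → ∣ K i ∣) (∈-allFin i))
               (λ ∣Ki∣≡0 → <⇒≱ (x∈p⇒1≤∣p∣ j∈Ki) (≤-reflexive ∣Ki∣≡0)))

  edge-meets-another-class : All (1 ≤_) σ → 2 ≤ length σ → {i : Fin n} {j : Fin q} → j ∈ K i →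
                             ∃ λ i′ → i′ ≢ i × Nonempty (K i′)
  edge-meets-another-class parts≥1 two≤s {i} j∈Ki
    with FinP.any? (λ i′ → ¬? (i′ F.≟ i) ×-dec nonempty? (K i′))
  ... | yes found = found
  ... | no none = contradiction ∑≤∣Ki∣ (<⇒≱ (subst (∣ K i ∣ <_) (sym edge-∑) ∣Ki∣<r))
    where
    ∣Ki∣<r : ∣ K i ∣ < sum σ
    ∣Ki∣<r = ∈⇒<sum parts≥1 two≤s (edge-∣class∣∈σ j∈Ki)
    ∣K∣≤0-elsewhere : ∀ i′ → i′ ≢ i → ∣ K i′ ∣ ≤ 0
    ∣K∣≤0-elsewhere i′ i′≢i = ≤-reflexive (trans (cong ∣_∣ (Empty-unique (λ ne → none (i′ , i′≢i , ne)))) (∣⊥∣≡0 q))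
    ∑≤∣Ki∣ : ∑ (λ i′ → ∣ K i′ ∣) ≤ ∣ K i ∣
    ∑≤∣Ki∣ = +-cancelʳ-≤ 0 _ _
      (subst (∑ (λ i′ → ∣ K i′ ∣) + 0 ≤_) (cong (∣ K i ∣ +_) (∑-zero {n}))
             (∑-≤-except {g = λ _ → 0} i ∣K∣≤0-elsewhere))

module Recolouring {n q k : ℕ} (c : Colouring n q k) (i : Fin n) where

  recolour : Colouring n q (suc k)
  recolour i′ j with i′ F.≟ i
  ... | yes _ = zero
  ... | no _  = suc (c i′ j)

  recolour-≡ : ∀ j → recolour i j ≡ zero
  recolour-≡ j with i F.≟ i
  ... | yes _   = refl
  ... | no i≢i = contradiction refl i≢i

  recolour-≢ : ∀ {i′} j → i′ ≢ i → recolour i′ j ≡ suc (c i′ j)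
  recolour-≢ {i′} j i′≢i with i′ F.≟ i
  ... | yes i′≡i = contradiction i′≡i i′≢i
  ... | no _     = refl

  AllColoursOutside : Set
  AllColoursOutside = ∀ x → ∃₂ λ i′ j → i′ ≢ i × c i′ j ≡ x

  recolour-usesAll : Fin q → AllColoursOutside → UsesAll recolour
  recolour-usesAll j _ zero = i , j , recolour-≡ j
  recolour-usesAll _ all-outside (suc x) with all-outside x
  ... | i′ , j , i′≢i , refl = i′ , j , recolour-≢ j i′≢i

  coloursOn-recolour-missing : {K : VSubset n q} → ¬ Nonempty (K i) →
                               coloursOn recolour K ≡ outside ∷ coloursOn c K
  coloursOn-recolour-missing {K} Ki-empty = ⊆-antisym ⊆-shifted shifted-⊆
    where
    class≢i : ∀ {i′ j} → j ∈ K i′ → i′ ≢ i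
    class≢i j∈Ki′ refl = Ki-empty (_ , j∈Ki′)
    ⊆-shifted : coloursOn recolour K ⊆ outside ∷ coloursOn c K
    ⊆-shifted x∈ with ∈-coloursOn⁻ recolour K x∈
    ... | i′ , j , j∈Ki′ , refl =
      subst (_∈ outside ∷ coloursOn c K) (sym (recolour-≢ j (class≢i j∈Ki′))) (there (∈-coloursOn⁺ c K j∈Ki′))
    shifted-⊆ : outside ∷ coloursOn c K ⊆ coloursOn recolour K
    shifted-⊆ (there x∈) with ∈-coloursOn⁻ c K x∈
    ... | i′ , j , j∈Ki′ , refl =
      subst (_∈ coloursOn recolour K) (recolour-≢ j (class≢i j∈Ki′)) (∈-coloursOn⁺ recolour K j∈Ki′)

  module _ {σ : List ℕ} {r δ β : ℕ} (part : IsPartition σ r) (smallest : IsSmallestPart δ σ)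
           (two≤s : 2 ≤ length σ) (r+1≤δ+β : r + 1 ≤ δ + β) where

    recolour-2β : Is2βColouring σ β c → Is2βColouring σ β recolour
    recolour-2β valid K edge with nonempty? (K i)
    ... | no Ki-empty =
      subst (λ m → 2 ≤ m × m ≤ β) (sym (cong ∣_∣ (coloursOn-recolour-missing {K} Ki-empty))) (valid K edge)
    ... | yes (j , j∈Ki) = at-least-two , at-most-β
      where
      at-least-two : 2 ≤ numColours recolour K
      at-least-two with edge-meets-another-class K edge (proj₁ part) two≤s j∈Ki
      ... | i′ , i′≢i , j′ , j′∈Ki′ = zero∈p⇒suc∈p⇒2≤∣p∣
        (subst (_∈ coloursOn recolour K) (recolour-≡ j) (∈-coloursOn⁺ recolour K j∈Ki))
        (subst (_∈ coloursOn recolour K) (recolour-≢ j′ i′≢i) (∈-coloursOn⁺ recolour K j′∈Ki′))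

      b : Fin n → ℕ
      b i′ = ∣ image (recolour i′) (K i′) ∣

      b-i≤1 : b i ≤ 1
      b-i≤1 = ≤-trans (p⊆q⇒∣p∣≤∣q∣ (image-const⊆⁅⁆ recolour-≡ (K i))) (≤-reflexive (∣⁅x⁆∣≡1 {suc k} zero))

      ∑b+δ≤β+δ : ∑ b + δ ≤ β + δ
      ∑b+δ≤β+δ = begin
        ∑ b + δ                 ≤⟨ +-monoʳ-≤ (∑ b) (All.lookup (proj₂ smallest) (edge-∣class∣∈σ K edge j∈Ki)) ⟩
        ∑ b + ∣ K i ∣           ≤⟨ ∑-≤-except i (λ i′ _ → ∣image∣≤∣∣ (recolour i′) (K i′)) ⟩
        b i + ∑ (λ i′ → ∣ K i′ ∣) ≤⟨ +-mono-≤ b-i≤1 (≤-reflexive (trans (edge-∑ K edge) (proj₂ part))) ⟩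
        1 + r                   ≡⟨ +-comm 1 r ⟩
        r + 1                   ≤⟨ r+1≤δ+β ⟩
        δ + β                   ≡⟨ +-comm δ β ⟩
        β + δ                   ∎
        where open ≤-Reasoning

      at-most-β : numColours recolour K ≤ β
      at-most-β = ≤-trans (numColours≤∑∣image∣ recolour K) (+-cancelʳ-≤ δ _ _ ∑b+δ≤β+δ)

open Recolouring

module _ {n q k : ℕ} {c : Colouring n q k} where

  private
    colour-outside? : ∀ i x → Dec (∃₂ λ i′ j → i′ ≢ i × c i′ j ≡ x)
    colour-outside? i x = FinP.any? (λ i′ → FinP.any? (λ j → ¬? (i′ F.≟ i) ×-dec (c i′ j F.≟ x)))

    owner-unique : ∀ {i x} → ¬ (∃₂ λ i′ j → i′ ≢ i × c i′ j ≡ x) → ∀ {i₀ j₀} → c i₀ j₀ ≡ x → i₀ ≡ i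
    owner-unique {i} not-outside {i₀} {j₀} c≡x with i₀ F.≟ i
    ... | yes i₀≡i = i₀≡i
    ... | no i₀≢i  = contradiction (i₀ , j₀ , i₀≢i , c≡x) not-outside

  -- Otherwise each class owns a colour used nowhere else; distinct classes own distinct
  -- colours, so n ≤ k.
  ∃-class-with-all-colours-outside : UsesAll c → k < n → ∃ (AllColoursOutside c)
  ∃-class-with-all-colours-outside uses k<n
    with FinP.any? (λ i → FinP.all? (colour-outside? i))
  ... | yes found = found
  ... | no none = contradiction (FinP.injective⇒≤ owned-injective) (<⇒≱ k<n)
    where
    owned : ∀ i → ∃ λ x → ¬ (∃₂ λ i′ j → i′ ≢ i × c i′ j ≡ x)
    owned i = FinP.¬∀⟶∃¬ k _ (colour-outside? i) (λ all → none (i , all))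
    owned-injective : ∀ {i i′} → proj₁ (owned i) ≡ proj₁ (owned i′) → i ≡ i′
    owned-injective {i} {i′} same with uses (proj₁ (owned i))
    ... | i₀ , j₀ , c≡x = trans (sym (owner-unique (proj₂ (owned i)) c≡x))
                                (owner-unique (proj₂ (owned i′)) (trans c≡x same))

ceilDiv≤ : ∀ m d → ceilDiv m d ≤ m
ceilDiv≤ m zero    = z≤n
ceilDiv≤ m (suc d) = s≤s⁻¹ (m<n*o⇒m/o<n (s≤s m+d≤d+m*[1+d]))
  where
  m+d≤d+m*[1+d] : m + d ≤ d + m * suc d
  m+d≤d+m*[1+d] = subst (_≤ d + m * suc d) (+-comm d m) (+-monoʳ-≤ d (m≤m*n m (suc d)))

module _ {σ : List ℕ} {r δ n q β : ℕ} (part : IsPartition σ r) (smallest : IsSmallestPart δ σ)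
         (two≤s : 2 ≤ length σ) (r+1≤δ+β : r + 1 ≤ δ + β) (vertex : Fin q) where

  spectrum-step : ∀ {k} → k < n → InSpectrum n q σ β k → InSpectrum n q σ β (suc k)
  spectrum-step k<n (c , uses , valid) with ∃-class-with-all-colours-outside uses k<n
  ... | i , all-outside =
    recolour c i , recolour-usesAll c i vertex all-outside , recolour-2β c i part smallest two≤s r+1≤δ+β valid

  spectrum-upto : ∀ {m k} → InSpectrum n q σ β m → m ≤′ k → k ≤ n → InSpectrum n q σ β k
  spectrum-upto m∈ ≤′-refl          _   = m∈
  spectrum-upto m∈ (≤′-step m≤′k) k<n = spectrum-step k<n (spectrum-upto m∈ m≤′k (<⇒≤ k<n))

proposition4p4 : (σ : List ℕ) (r δ n q β : ℕ) →
    1 ≤ r → IsPartition σ r → IsSmallestPart δ σ →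
    1 ≤ n → 1 ≤ q →
    2 ≤ length σ → length σ ≤ β → r + 1 ≤ δ + β →
    (χ : ℕ) → IsChi2β n q σ β χ →
    (k : ℕ) → χ ≤ k → k ≤ ceilDiv n (length σ ∸ 1) →
    InSpectrum n q σ β k
proposition4p4 σ r δ n q β _ part smallest _ 1≤q two≤s _ r+1≤δ+β χ (χ∈spectrum , _) k χ≤k k≤⌈n/s-1⌉ =
  spectrum-upto part smallest two≤s r+1≤δ+β (F.fromℕ< 1≤q) χ∈spectrum (≤⇒≤′ χ≤k)
    (≤-trans k≤⌈n/s-1⌉ (ceilDiv≤ n (length σ ∸ 1)))
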